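{- Let $\vec{S}_4$ be the directed graph on $\{1,2,3,4\}$ with arcs $\vec{12},\vec{13},\vec{14}$, let $K_4^-$ be the $3$-graph on $4$ vertices with exactly $3$ edges, and let $C_5$ be the $3$-graph on $\{1,\dots,5\}$ with edges $123,234,345,451,512$. Then \[\pi_{\vec{S}_4}(\emptyset)\le \pi_{K_4^- }(\{C_5\}).\]
   Context: A directed graph is a pair $(V,E)$ with $E$ a set of ordered pairs of distinct vertices; a vertex set $S$ induces a copy of a directed graph $H$ if the arcs of $E$ within $S$ form a directed graph isomorphic to $H$. For a directed graph $H$ on $h$ vertices, $\pi_H(\emptyset)=\lim_{n\to\infty}\max_D e_H(D)/\binom{n}{h}$ over directed graphs $D$ on $n$ vertices, $e_H(D)$ counting $h$-subsets inducing a copy of $H$. A $3$-graph is a pair $(V,E)$ with $E$ a set of $3$-element subsets of $V$. For a $3$-graph $H$ on $h$ vertices, $e_H(G)$ counts $h$-subsets of $V(G)$ inducing a copy of $H$; $G$ is $\mathcal{F}$-free if it contains no member of $\mathcal{F}$ as a (not necessarily induced) subgraph; $\pi_H(\mathcal{F})=\lim_{n\to\infty}\max\{e_H(G): G \text{ $\mathcal{F}$-free}, |V(G)|=n\}/\binom{n}{h}$ (the limits exist). -}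

module Defs where

open import Data.Bool using (Bool; true; false; _∧_; _∨_; not; if_then_else_)
open import Data.Nat using (ℕ; zero; suc)
open import Data.Fin using (Fin; zero; suc; _<?_; _≟_)
open import Data.Vec using (Vec; []; _∷_; lookup)
open import Data.List using (List; []; _∷_; length; filter; concatMap; map; allFin)
open import Data.Bool.ListAction using (and; or)
open import Data.Integer using (+_)
open import Data.Rational using (ℚ; _/_)
open import Data.Product using (_×_; _,_)
open import Relation.Binary.PropositionalEquality using (_≡_)
open import Relation.Nullary.Decidable using (⌊_⌋)
open import Function.Definitions using (Injective)
import Data.Empty

ℕ→ℚ : ℕ → ℚ
ℕ→ℚ k = (+ k) / 1

-- Directed graphs on vertex set Fin n: arc (u , v) present iff arc u v ≡ true.
-- Values on the diagonal (u ≡ v) are never consulted (no loops).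

Digraph : ℕ → Set
Digraph n = Fin n → Fin n → Bool

-- 3-graphs on vertex set Fin n: the 3-set {x,y,z} (x,y,z distinct) is an
-- edge iff edge x y z ≡ true; the function is required to be symmetric so
-- that it really describes a set of 3-element subsets.  Values on triples
-- with repeated vertices are never consulted.

record Graph3 (n : ℕ) : Set where
  field
    edge : Fin n → Fin n → Fin n → Bool
    sym₁₂ : ∀ x y z → edge x y z ≡ edge y x z
    sym₂₃ : ∀ x y z → edge x y z ≡ edge x z y
open Graph3 public

_==ᵇ_ : Bool → Bool → Bool
true  ==ᵇ b = b
false ==ᵇ b = not b

_≠ᶠ_ : ∀ {n} → Fin n → Fin n → Bool
i ≠ᶠ j = not ⌊ i ≟ j ⌋

_<ᶠ_ : ∀ {n} → Fin n → Fin n → Bool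
i <ᶠ j = ⌊ i <? j ⌋

4-subsets : (n : ℕ) → List (Vec (Fin n) 4)
4-subsets n =
  concatMap (λ a → concatMap (λ b → concatMap (λ c → concatMap (λ d →
    if (a <ᶠ b) ∧ (b <ᶠ c) ∧ (c <ᶠ d) then (a ∷ b ∷ c ∷ d ∷ []) ∷ [] else [])
    (allFin n)) (allFin n)) (allFin n)) (allFin n)

allMaps4 : List (Vec (Fin 4) 4)
allMaps4 =
  concatMap (λ a → concatMap (λ b → concatMap (λ c → map (λ d → a ∷ b ∷ c ∷ d ∷ [])
    (allFin 4)) (allFin 4)) (allFin 4)) (allFin 4)

isBij4 : Vec (Fin 4) 4 → Bool
isBij4 σ = and (concatMap (λ i → map (λ j → not (i ≠ᶠ j) ∨ (lookup σ i ≠ᶠ lookup σ j))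
  (allFin 4)) (allFin 4))

bijections4 : List (Vec (Fin 4) 4)
bijections4 = filter (λ σ → isBij4 σ Data.Bool.≟ true) allMaps4

-- The 4-set S = {v₀,v₁,v₂,v₃} induces a copy of H (on vertex set Fin 4) iff
-- there is a bijection g : Fin 4 → S (g = v ∘ σ, σ a permutation) which is an
-- isomorphism between H and the structure induced on S.

inducesD : ∀ {n} → Digraph n → Digraph 4 → Vec (Fin n) 4 → Bool
inducesD D H v = or (map (λ σ → and (concatMap (λ i → map (λ j →
    not (i ≠ᶠ j) ∨ (D (lookup v (lookup σ i)) (lookup v (lookup σ j)) ==ᵇ H i j))
    (allFin 4)) (allFin 4))) bijections4)

induces3 : ∀ {n} → Graph3 n → Graph3 4 → Vec (Fin n) 4 → Bool
induces3 G H v = or (map (λ σ → and (concatMap (λ i → concatMap (λ j → map (λ k →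
    not ((i <ᶠ j) ∧ (j <ᶠ k)) ∨
      (edge G (lookup v (lookup σ i)) (lookup v (lookup σ j)) (lookup v (lookup σ k))
        ==ᵇ edge H i j k))
    (allFin 4)) (allFin 4)) (allFin 4))) bijections4)

eD : ∀ {n} → Digraph 4 → Digraph n → ℕ
eD {n} H D = length (filter (λ v → inducesD D H v Data.Bool.≟ true) (4-subsets n))

e3 : ∀ {n} → Graph3 4 → Graph3 n → ℕ
e3 {n} H G = length (filter (λ v → induces3 G H v Data.Bool.≟ true) (4-subsets n))

-- The specific graphs (vertices 1,2,3,4 of the paper are 0,1,2,3 here).

-- S⃗₄ : arcs 1→2, 1→3, 1→4, i.e. (i , j) is an arc iff i = 0 (and j ≠ i)
isZero : Fin 4 → Bool
isZero zero = true
isZero (suc _) = false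

S4 : Digraph 4
S4 i j = isZero i

-- K₄⁻ : the 3-graph on 4 vertices with exactly 3 edges, namely 123,124,134
-- (paper labels), i.e. the 3-sets containing vertex 0
K4⁻ : Graph3 4
K4⁻ = record { edge = λ i j k → isZero i ∨ isZero j ∨ isZero k
             ; sym₁₂ = p ; sym₂₃ = q }
  where
  p : ∀ x y z → (isZero x ∨ isZero y ∨ isZero z) ≡ (isZero y ∨ isZero x ∨ isZero z)
  p zero zero z = Relation.Binary.PropositionalEquality.refl
  p zero (suc y) z = Relation.Binary.PropositionalEquality.refl
  p (suc x) zero z = Relation.Binary.PropositionalEquality.refl
  p (suc x) (suc y) z = Relation.Binary.PropositionalEquality.refl
  q : ∀ x y z → (isZero x ∨ isZero y ∨ isZero z) ≡ (isZero x ∨ isZero z ∨ isZero y)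
  q zero y z = Relation.Binary.PropositionalEquality.refl
  q (suc x) zero zero = Relation.Binary.PropositionalEquality.refl
  q (suc x) zero (suc z) = Relation.Binary.PropositionalEquality.refl
  q (suc x) (suc y) zero = Relation.Binary.PropositionalEquality.refl
  q (suc x) (suc y) (suc z) = Relation.Binary.PropositionalEquality.refl

-- C₅-freeness (C₅ not contained as a, not necessarily induced, subgraph):
-- no injective f : Fin 5 → Fin n maps all edges 123,234,345,451,512 of C₅
-- (paper labels; here 012,123,234,340,401) onto edges of G.
C5-free : ∀ {n} → Graph3 n → Set
C5-free {n} G = (f : Fin 5 → Fin n) → Injective _≡_ _≡_ f →
  ¬C5 f
  where
  v0 v1 v2 v3 v4 : Fin 5
  v0 = zero
  v1 = suc zero
  v2 = suc (suc zero)
  v3 = suc (suc (suc zero))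
  v4 = suc (suc (suc (suc zero)))
  ¬C5 : (Fin 5 → Fin n) → Set
  ¬C5 f = edge G (f v0) (f v1) (f v2) ≡ true × edge G (f v1) (f v2) (f v3) ≡ true
        × edge G (f v2) (f v3) (f v4) ≡ true × edge G (f v3) (f v4) (f v0) ≡ true
        × edge G (f v4) (f v0) (f v1) ≡ true → Data.Empty.⊥

{-# OPTIONS --safe #-}
-- The 3-graph G(D) whose edges are the triples spanning an out-star of D
-- (one vertex sends arcs to the other two, and there are no further arcs)
-- already works for every n, with no error term.  A 4-set inducing S⃗₄ with
-- centre c has exactly the three triples through c as out-stars, so it
-- induces K₄⁻ in G(D).  For C₅-freeness, record on each pair x y the arcs
-- (x → y , y → x): along an edge xyz of G(D) the pattern on xy determines
-- the one on yz by forward ⇝ none ⇝ backward ⇝ forward, and a 3-cycle has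
-- no closed walk of length 5.
module Submission where

open import Defs
open import Data.Nat using (ℕ; _≤_)
open import Data.Nat.Combinatorics using (_C_)
open import Data.Product using (∃-syntax; Σ-syntax; _×_)
open import Data.Rational using (ℚ; Positive; _+_; _*_)
open import Data.Rational using () renaming (_≤_ to _≤ℚ_)

open import Algebra.Bundles using (CommutativeMonoid)
open import Data.Bool using (Bool; true; false; _∧_; _∨_; not; T)
import Data.Bool as Bool
open import Data.Bool.ListAction using (and; any)
open import Data.Bool.Properties using (∧-comm; ∨-comm; ∨-commutativeMonoid; T-∧; T-≡)
open import Data.Empty using (⊥)
open import Data.Fin using (Fin; zero; suc)
open import Data.List using (map; concatMap; filter; length)
import Data.List as List
open import Data.List.Relation.Binary.Sublist.Propositional using (⊆-refl)
open import Data.List.Relation.Binary.Sublist.Propositional.Properties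
  using (filter⁺; length-mono-≤)
import Data.List.Relation.Unary.Any as Any
open import Data.List.Relation.Unary.Any.Properties using (any⁺; any⁻)
open import Data.Product using (_,_; proj₁; proj₂)
open import Data.Sum using (_⊎_; inj₁; inj₂)
open import Data.Vec using (Vec; []; _∷_; lookup; allFin)
import Data.Vec as Vec
open import Function using (_∘_; Equivalence)
open import Relation.Unary using (Decidable)
open import Relation.Binary.PropositionalEquality
  using (_≡_; refl; sym; trans; cong; cong₂; subst₂)
open import Algebra.Properties.CommutativeSemigroup
  (CommutativeMonoid.commutativeSemigroup ∨-commutativeMonoid) using (x∙yz≈y∙xz)

import Data.Integer as ℤ
import Data.Integer.Properties as ℤ
import Data.Nat.Coprimality as Coprime
import Data.Rational as ℚ
import Data.Rational.Properties as ℚ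

∨-true : ∀ a {b} → a ∨ b ≡ true → a ≡ true ⊎ b ≡ true
∨-true true  _ = inj₁ refl
∨-true false p = inj₂ p

_⇒ᵇ_ : Bool → Bool → Bool
a ⇒ᵇ b = not a ∨ b

T-⇒ᵇ : ∀ a {b} → T (a ⇒ᵇ b) → T a → T b
T-⇒ᵇ true t _ = t

everyᵇ : ∀ {k} → (Vec Bool k → Bool) → Bool
everyᵇ {ℕ.zero}  p = p []
everyᵇ {ℕ.suc k} p = everyᵇ (p ∘ (true ∷_)) ∧ everyᵇ (p ∘ (false ∷_))

everyᵇ-sound : ∀ {k} (p : Vec Bool k → Bool) → T (everyᵇ p) → ∀ w → T (p w)
everyᵇ-sound p t []          = t
everyᵇ-sound p t (true ∷ w)  = everyᵇ-sound (p ∘ (true ∷_)) (proj₁ (Equivalence.to T-∧ t)) w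
everyᵇ-sound p t (false ∷ w) = everyᵇ-sound (p ∘ (false ∷_)) (proj₂ (Equivalence.to T-∧ t)) w

any-mono : ∀ {A : Set} {p q : A → Bool} → (∀ x → T (p x) → T (q x)) →
  ∀ xs → T (any p xs) → T (any q xs)
any-mono {q = q} p⇒q xs = any⁺ q ∘ Any.map (p⇒q _) ∘ any⁻ _ xs

length-filter-mono : ∀ {A : Set} {P Q : A → Set} (P? : Decidable P) (Q? : Decidable Q) →
  (∀ {x} → P x → Q x) → ∀ xs → length (filter P? xs) ≤ length (filter Q? xs)
length-filter-mono P? Q? P⇒Q xs =
  length-mono-≤ (filter⁺ P? Q? (λ { refl → P⇒Q }) (⊆-refl {x = xs}))

ℕ→ℚ≡mkℚ : ∀ k → ℕ→ℚ k ≡ ℚ.mkℚ (ℤ.+ k) 0 (Coprime.sym (Coprime.1-coprimeTo k))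
ℕ→ℚ≡mkℚ k = ℚ.normalize-coprime (Coprime.sym (Coprime.1-coprimeTo k))

ℕ→ℚ-mono-≤ : ∀ {a b} → a ≤ b → ℕ→ℚ a ≤ℚ ℕ→ℚ b
ℕ→ℚ-mono-≤ {a} {b} a≤b rewrite ℕ→ℚ≡mkℚ a | ℕ→ℚ≡mkℚ b =
  ℚ.*≤* (ℤ.*-monoʳ-≤-nonNeg (ℤ.+ 1) (ℤ.+≤+ a≤b))

ℕ→ℚ-nonNeg : ∀ k → ℚ.NonNegative (ℕ→ℚ k)
ℕ→ℚ-nonNeg k rewrite ℕ→ℚ≡mkℚ k = _

p≤q⇒p≤q+r : ∀ {p q} r .{{_ : ℚ.NonNegative r}} → p ≤ℚ q → p ≤ℚ q + r
p≤q⇒p≤q+r {p} r p≤q = ℚ.≤-trans (ℚ.≤-reflexive (sym (ℚ.+-identityʳ p)))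
  (ℚ.+-mono-≤ p≤q (ℚ.nonNegative⁻¹ r))

outStar : ∀ {n} → Digraph n → Fin n → Fin n → Fin n → Bool
outStar D x y z = (D x y ∧ D x z) ∧ not (D y x ∨ D z x) ∧ not (D y z ∨ D z y)

outStar-swap : ∀ {n} (D : Digraph n) x y z → outStar D x y z ≡ outStar D x z y
outStar-swap D x y z =
  cong₂ _∧_ (∧-comm (D x y) (D x z))
    (cong₂ _∧_ (cong not (∨-comm (D y x) (D z x)))
               (cong not (∨-comm (D y z) (D z y))))

outStar-true : ∀ {n} (D : Digraph n) x y z → outStar D x y z ≡ true →
  D x y ≡ true × D x z ≡ true × D y x ≡ false × D z x ≡ false × D y z ≡ false × D z y ≡ false
outStar-true D x y z = true-only (D x y) (D x z) (D y x) (D z x) (D y z) (D z y)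
  where
  true-only : ∀ xy xz yx zx yz zy → (xy ∧ xz) ∧ not (yx ∨ zx) ∧ not (yz ∨ zy) ≡ true →
    xy ≡ true × xz ≡ true × yx ≡ false × zx ≡ false × yz ≡ false × zy ≡ false
  true-only true  true  false false false false _ = refl , refl , refl , refl , refl , refl
  true-only false _     _     _     _     _     ()
  true-only true  false _     _     _     _     ()
  true-only true  true  true  _     _     _     ()
  true-only true  true  false true  _     _     ()
  true-only true  true  false false true  _     ()
  true-only true  true  false false false true  ()

outStarGraph : ∀ {n} → Digraph n → Graph3 n
outStarGraph D = record
  { edge  = λ x y z → outStar D x y z ∨ outStar D y x z ∨ outStar D z x y
  ; sym₁₂ = λ x y z → trans (x∙yz≈y∙xz (outStar D x y z) (outStar D y x z) _)
                        (cong (λ c → outStar D y x z ∨ outStar D x y z ∨ c)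
                              (outStar-swap D z x y))
  ; sym₂₃ = λ x y z → cong₂ _∨_ (outStar-swap D x y z)
                        (∨-comm (outStar D y x z) (outStar D z x y))
  }

arcs : ∀ {n} → Digraph n → Fin n → Fin n → Bool × Bool
arcs D x y = D x y , D y x

infix 4 _⇝_

data _⇝_ : Bool × Bool → Bool × Bool → Set where
  forward⇝none     : (true , false) ⇝ (false , false)
  none⇝backward    : (false , false) ⇝ (false , true)
  backward⇝forward : (false , true) ⇝ (true , false)

⇝-no-5-cycle : ∀ {p₀ p₁ p₂ p₃ p₄} →
  p₀ ⇝ p₁ → p₁ ⇝ p₂ → p₂ ⇝ p₃ → p₃ ⇝ p₄ → p₄ ⇝ p₀ → ⊥
⇝-no-5-cycle forward⇝none none⇝backward backward⇝forward forward⇝none ()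
⇝-no-5-cycle none⇝backward backward⇝forward forward⇝none none⇝backward ()
⇝-no-5-cycle backward⇝forward forward⇝none none⇝backward backward⇝forward ()

outStarGraph-edge⇒⇝ : ∀ {n} (D : Digraph n) {x y z} →
  edge (outStarGraph D) x y z ≡ true → arcs D x y ⇝ arcs D y z
outStarGraph-edge⇒⇝ D {x} {y} {z} e with ∨-true (outStar D x y z) e
... | inj₁ centre-x
  with xy , _ , yx , _ , yz , zy ← outStar-true D x y z centre-x
  = subst₂ _⇝_ (sym (cong₂ _,_ xy yx)) (sym (cong₂ _,_ yz zy)) forward⇝none
... | inj₂ e′ with ∨-true (outStar D y x z) e′
...   | inj₁ centre-y
  with yx , yz , xy , zy , _ , _ ← outStar-true D y x z centre-y
  = subst₂ _⇝_ (sym (cong₂ _,_ xy yx)) (sym (cong₂ _,_ yz zy)) backward⇝forward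
...   | inj₂ centre-z
  with _ , zy , _ , yz , xy , yx ← outStar-true D z x y centre-z
  = subst₂ _⇝_ (sym (cong₂ _,_ xy yx)) (sym (cong₂ _,_ yz zy)) none⇝backward

outStarGraph-C5-free : ∀ {n} (D : Digraph n) → C5-free (outStarGraph D)
outStarGraph-C5-free D _ _ (e₀ , e₁ , e₂ , e₃ , e₄) =
  ⇝-no-5-cycle (outStarGraph-edge⇒⇝ D e₀) (outStarGraph-edge⇒⇝ D e₁)
    (outStarGraph-edge⇒⇝ D e₂) (outStarGraph-edge⇒⇝ D e₃) (outStarGraph-edge⇒⇝ D e₄)

-- The test that inducesD (resp. induces3) runs for one bijection σ: inducesD D H v
-- is definitionally any (isIsoᴰ D H v) bijections4.
isIsoᴰ : ∀ {n} → Digraph n → Digraph 4 → Vec (Fin n) 4 → Vec (Fin 4) 4 → Bool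
isIsoᴰ D H v σ = and (concatMap (λ i → map (λ j →
    not (i ≠ᶠ j) ∨ (D (lookup v (lookup σ i)) (lookup v (lookup σ j)) ==ᵇ H i j))
    (List.allFin 4)) (List.allFin 4))

isIso³ : ∀ {n} → Graph3 n → Graph3 4 → Vec (Fin n) 4 → Vec (Fin 4) 4 → Bool
isIso³ G H v σ = and (concatMap (λ i → concatMap (λ j → map (λ k →
    not ((i <ᶠ j) ∧ (j <ᶠ k)) ∨
      (edge G (lookup v (lookup σ i)) (lookup v (lookup σ j)) (lookup v (lookup σ k))
        ==ᵇ edge H i j k))
    (List.allFin 4)) (List.allFin 4)) (List.allFin 4))

arcsAmong : ∀ {n} → Digraph n → Vec (Fin n) 4 → Vec Bool 12
arcsAmong D (x₀ ∷ x₁ ∷ x₂ ∷ x₃ ∷ []) =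
  D x₀ x₁ ∷ D x₀ x₂ ∷ D x₀ x₃ ∷ D x₁ x₀ ∷ D x₁ x₂ ∷ D x₁ x₃ ∷
  D x₂ x₀ ∷ D x₂ x₁ ∷ D x₂ x₃ ∷ D x₃ x₀ ∷ D x₃ x₁ ∷ D x₃ x₂ ∷ []

digraphWithArcs : Vec Bool 12 → Digraph 4
digraphWithArcs (a₀₁ ∷ a₀₂ ∷ a₀₃ ∷ a₁₀ ∷ a₁₂ ∷ a₁₃ ∷ a₂₀ ∷ a₂₁ ∷ a₂₃ ∷ a₃₀ ∷ a₃₁ ∷ a₃₂ ∷ []) = H
  where
  H : Digraph 4
  H zero                   (suc zero)             = a₀₁
  H zero                   (suc (suc zero))       = a₀₂
  H zero                   (suc (suc (suc zero))) = a₀₃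
  H (suc zero)             zero                   = a₁₀
  H (suc zero)             (suc (suc zero))       = a₁₂
  H (suc zero)             (suc (suc (suc zero))) = a₁₃
  H (suc (suc zero))       zero                   = a₂₀
  H (suc (suc zero))       (suc zero)             = a₂₁
  H (suc (suc zero))       (suc (suc (suc zero))) = a₂₃
  H (suc (suc (suc zero))) zero                   = a₃₀
  H (suc (suc (suc zero))) (suc zero)             = a₃₁
  H (suc (suc (suc zero))) (suc (suc zero))       = a₃₂
  H _                      _                      = false

S4-iso⇒K4⁻-isoᵇ : Vec Bool 12 → Bool
S4-iso⇒K4⁻-isoᵇ w =
  isIsoᴰ H S4 (allFin 4) (allFin 4) ⇒ᵇ isIso³ (outStarGraph H) K4⁻ (allFin 4) (allFin 4)
  where H = digraphWithArcs w

-- Both tests only read the 12 arcs among v ∘ σ, so they agree definitionally with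
-- the tests on digraphWithArcs (arcsAmong D (v ∘ σ)), and everyᵇ checks all of these.
S4-iso⇒K4⁻-iso : ∀ {n} (D : Digraph n) v σ →
  T (isIsoᴰ D S4 v σ) → T (isIso³ (outStarGraph D) K4⁻ v σ)
S4-iso⇒K4⁻-iso D v σ@(_ ∷ _ ∷ _ ∷ _ ∷ []) =
  T-⇒ᵇ (isIsoᴰ D S4 v σ)
    (everyᵇ-sound S4-iso⇒K4⁻-isoᵇ _ (arcsAmong D (Vec.map (lookup v) σ)))

S4-copy⇒K4⁻-copy : ∀ {n} (D : Digraph n) v →
  inducesD D S4 v ≡ true → induces3 (outStarGraph D) K4⁻ v ≡ true
S4-copy⇒K4⁻-copy D v =
  Equivalence.to T-≡ ∘ any-mono (S4-iso⇒K4⁻-iso D v) bijections4 ∘ Equivalence.from T-≡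

eD-S4≤e3-K4⁻ : ∀ {n} (D : Digraph n) → eD S4 D ≤ e3 K4⁻ (outStarGraph D)
eD-S4≤e3-K4⁻ {n} D =
  length-filter-mono (λ v → inducesD D S4 v Bool.≟ true)
    (λ v → induces3 (outStarGraph D) K4⁻ v Bool.≟ true)
    (λ {v} → S4-copy⇒K4⁻-copy D v) (4-subsets n)

proposition3p5 : (ε : ℚ) → Positive ε →
    ∃[ N ] ((n : ℕ) → N ≤ n → (D : Digraph n) →
      Σ[ G ∈ Graph3 n ] (C5-free G ×
        (ℕ→ℚ (eD S4 D) ≤ℚ ℕ→ℚ (e3 K4⁻ G) + ε * ℕ→ℚ (n C 4))))
proposition3p5 ε ε>0 = 0 , λ n _ D →
  outStarGraph D , outStarGraph-C5-free D ,
  p≤q⇒p≤q+r (ε * ℕ→ℚ (n C 4)) {{ε*-nonNeg (n C 4)}} (ℕ→ℚ-mono-≤ (eD-S4≤e3-K4⁻ D))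
  where
  ε*-nonNeg : ∀ k → ℚ.NonNegative (ε * ℕ→ℚ k)
  ε*-nonNeg k =
    ℚ.nonNeg*nonNeg⇒nonNeg ε {{ℚ.pos⇒nonNeg ε {{ε>0}}}} (ℕ→ℚ k) {{ℕ→ℚ-nonNeg k}}
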